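{- Let $G$ be a finite simple graph with vertex set $[n]$ whose natural ordering is a quasi-perfect ordering. Then (1) every cycle of $G$ of length at least $5$ has a chord; and (2) if $G$ has no 3-cycles, then $G$ is bipartite.
   Context: A candidate path in $G$ is a path $a,c,b,v_1,\dots,v_m=d$ with $a<b<c$, $m\ge1$, and $v_m$ the only $v_i$ smaller than $c$. The ordering is a quasi-perfect ordering (QPO) if every candidate path satisfies: either $ad\in E(G)$, or else $d<b$ and $cd\in E(G)$. -}

module Defs where

open import Data.Nat using (ℕ; suc; _∸_; _≥_)
open import Data.Fin using (Fin; toℕ; _<_; _≤_)
open import Data.Bool using (Bool)
open import Data.List using (List; []; _∷_; _∷ʳ_)
open import Data.List.Relation.Unary.All using (All)
open import Data.List.Relation.Unary.Linked using (Linked)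
open import Data.List.Relation.Unary.Unique.Propositional using (Unique)
open import Data.Product using (Σ; _×_; ∃)
open import Data.Sum using (_⊎_)
open import Data.Empty using (⊥)
open import Function.Definitions using (Injective)
open import Relation.Binary.PropositionalEquality using (_≡_; _≢_)
open import Relation.Binary.Definitions using (Decidable)
open import Relation.Nullary using (¬_)

-- A finite simple graph on the vertex set [n], represented as Fin n
-- (vertex i of Fin n stands for i+1; the natural order is that of Fin).
record Graph (n : ℕ) : Set₁ where
  field
    E     : Fin n → Fin n → Set
    E?    : Decidable E
    sym   : ∀ {u v} → E u v → E v u
    irrefl : ∀ {u} → ¬ E u u
open Graph public

IsPath : ∀ {n} → Graph n → List (Fin n) → Set
IsPath G vs = Unique vs × Linked (E G) vs

-- Candidate path a, c, b, v_1, ..., v_{m-1}, v_m = d (m ≥ 1), with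
-- a < b < c, and v_m the only v_i smaller than c.
-- Here vs = [v_1, ..., v_{m-1}] (possibly empty) and d = v_m.
CandidatePath : ∀ {n} → Graph n → Fin n → Fin n → Fin n → List (Fin n) → Fin n → Set
CandidatePath G a c b vs d =
  a < b × b < c × All (λ v → c ≤ v) vs × d < c ×
  IsPath G (a ∷ c ∷ b ∷ (vs ∷ʳ d))

IsQPO : ∀ {n} → Graph n → Set
IsQPO G = ∀ a c b vs d → CandidatePath G a c b vs d →
  E G a d ⊎ (d < b × E G c d)

CycConsec : ∀ {k} → Fin k → Fin k → Set
CycConsec {k} i j = toℕ j ≡ suc (toℕ i) ⊎ (toℕ i ≡ k ∸ 1 × toℕ j ≡ 0)

IsCycle : ∀ {n} → Graph n → (k : ℕ) → (Fin k → Fin n) → Set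
IsCycle G k f = Injective _≡_ _≡_ f × (∀ i j → CycConsec i j → E G (f i) (f j))

HasChord : ∀ {n} → Graph n → (k : ℕ) → (Fin k → Fin n) → Set
HasChord G k f = Σ (Fin k) λ i → Σ (Fin k) λ j →
  i ≢ j × ¬ CycConsec i j × ¬ CycConsec j i × E G (f i) (f j)

TriangleFree : ∀ {n} → Graph n → Set
TriangleFree G = ∀ (f : Fin 3 → Fin _) → ¬ IsCycle G 3 f

Bipartite : ∀ {n} → Graph n → Set
Bipartite {n} G = Σ (Fin n → Bool) λ col → ∀ u v → E G u v → col u ≢ col v

module Submission where

-- Both parts only ever use candidate paths of the shortest kind, a c b d
-- (m = 1): if a < b < c, d < c, a ≠ d and a–c–b–d is a walk, then the QPO
-- condition gives an edge ad or cd ('shortCandidate').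
--
-- (1) On a cycle of length k ≥ 5 let c be its largest vertex, a < b its two
-- cycle neighbours, and d the cycle vertex following b away from c.  Then a c b d is a
-- short candidate path, and both ad and cd join positions at cyclic distance
-- 3 resp. 2, which are chords because k ≥ 5.  Cycle positions are handled
-- as natural numbers reduced modulo k ('CyclicPositions').
--
-- (2) We 2-colour the initial segments {0, …, m-1} one vertex at a time.
-- When c = m is added, its earlier neighbours are pairwise non-adjacent
-- (no triangles) and we recolour them all with the colour β of the least of
-- them, a, and c with not β.  A short candidate path a c u v shows that every
-- earlier non-neighbour v of c adjacent to an earlier neighbour u is adjacent
-- to a, hence already differs from β, so the recolouring stays proper.

open import Defs
open import Data.Nat as ℕ using (ℕ; zero; suc; _+_; _*_; _∸_; _≥_; _%_; _/_; z≤n; s≤s)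
import Data.Nat.Properties as ℕP
open import Data.Nat.DivMod
  using (m≡m%n+[m/n]*n; [m+kn]%n≡m%n; [m+n]%n≡m%n; m≤n⇒[n∸m]%m≡n%m;
         m%n≤m; m%n<n; m<n⇒m%n≡m; n%n≡0)
open import Data.Fin using (Fin; toℕ; fromℕ<; _<_; _≤_) renaming (zero to fzero; suc to fsuc)
import Data.Fin.Properties as FinP
open import Data.Fin.Patterns using (0F; 1F; 2F)
open import Data.Bool using (Bool; true; not)
open import Data.Bool.Properties using (not-¬)
open import Data.Product using (Σ; _×_; _,_; proj₁; proj₂)
open import Data.Sum using (_⊎_; inj₁; inj₂)
open import Data.Empty using (⊥; ⊥-elim)
open import Data.List using ([]; _∷_)
open import Data.List.Relation.Unary.Unique.Propositional using (Unique)
open import Data.List.Relation.Unary.AllPairs using ([]; _∷_)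
open import Data.List.Relation.Unary.All using ([]; _∷_)
open import Data.List.Relation.Unary.Linked using ([-]; _∷_)
open import Relation.Binary.Definitions using (tri<; tri≈; tri>)
open import Relation.Binary.PropositionalEquality
  using (_≡_; _≢_; refl; cong; trans; subst; ≢-sym; module ≡-Reasoning)
  renaming (sym to ≡-sym)
open import Relation.Nullary using (¬_; Dec; yes; no)
open import Relation.Nullary.Decidable using (_×-dec_)

adjacent⇒distinct : ∀ {n} (G : Graph n) {u v : Fin n} → E G u v → u ≢ v
adjacent⇒distinct G e refl = irrefl G e

-- The QPO condition for candidate paths a c b d with m = 1: the inner
-- vertex list is empty, so only the distinctness of a and d is a real
-- hypothesis; the other distinctness facts follow from the order and edges.
shortCandidate : ∀ {n} (G : Graph n) → IsQPO G → ∀ {a b c d : Fin n} →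
  a < b → b < c → d < c → a ≢ d → E G a c → E G c b → E G b d →
  E G a d ⊎ E G c d
shortCandidate G qpo {a} {b} {c} {d} a<b b<c d<c a≢d eac ecb ebd
  with qpo a c b [] d (a<b , b<c , [] , d<c , unique , eac ∷ ecb ∷ ebd ∷ [-])
  where
  unique : Unique (a ∷ c ∷ b ∷ d ∷ [])
  unique = (adjacent⇒distinct G eac ∷ FinP.<⇒≢ a<b ∷ a≢d ∷ []) ∷
           (adjacent⇒distinct G ecb ∷ ≢-sym (FinP.<⇒≢ d<c) ∷ []) ∷
           (adjacent⇒distinct G ebd ∷ []) ∷ [] ∷ []
... | inj₁ ead = inj₁ ead
... | inj₂ (_ , ecd) = inj₂ ecd

maximumAt : ∀ {m n} (g : Fin (suc m) → Fin n) → Σ (Fin (suc m)) λ i → ∀ j → g j ≤ g i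
maximumAt {zero} g = fzero , λ { fzero → FinP.≤-refl }
maximumAt {suc m} g with maximumAt (λ j → g (fsuc j))
... | i , top with FinP.≤-total (g fzero) (g (fsuc i))
...   | inj₁ g0≤gi = fsuc i , λ { fzero → g0≤gi ; (fsuc j) → top j }
...   | inj₂ gi≤g0 = fzero , λ { fzero → FinP.≤-refl ; (fsuc j) → FinP.≤-trans (top j) gi≤g0 }

module CyclicPositions (k : ℕ) where

  K : ℕ
  K = suc k

  position : ℕ → Fin K
  position x = fromℕ< (m%n<n x K)

  toℕ-position : ∀ x → toℕ (position x) ≡ x % K
  toℕ-position x = FinP.toℕ-fromℕ< (m%n<n x K)

  %-absorbʳ : ∀ a x → (a + x) % K ≡ (a + x % K) % K
  %-absorbʳ a x = begin
    (a + x) % K                   ≡⟨ cong (λ t → (a + t) % K) (m≡m%n+[m/n]*n x K) ⟩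
    (a + (x % K + x / K * K)) % K ≡⟨ cong (_% K) (≡-sym (ℕP.+-assoc a (x % K) _)) ⟩
    (a + x % K + x / K * K) % K   ≡⟨ [m+kn]%n≡m%n (a + x % K) (x / K) K ⟩
    (a + x % K) % K               ∎
    where open ≡-Reasoning

  shift-moves : ∀ e x → suc e ℕ.< K → (suc e + x) % K ≢ x % K
  shift-moves e x e<K eq =
    moves (x % K) (trans (≡-sym (%-absorbʳ (suc e) x)) eq)
    where
    moves : ∀ r → (suc e + r) % K ≢ r
    moves r eq with suc e + r ℕP.<? K
    ... | yes small = ℕP.m≢1+n+m r (≡-sym (trans (≡-sym (m<n⇒m%n≡m small)) eq))
    ... | no large = ℕP.<⇒≱ e<K (ℕP.+-cancelˡ-≤ r K (suc e) (begin
        r + K                   ≤⟨ ℕP.+-monoˡ-≤ K r≤wrapped ⟩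
        (suc e + r ∸ K) + K     ≡⟨ ℕP.m∸n+n≡m K≤sum ⟩
        suc e + r               ≡⟨ ℕP.+-comm (suc e) r ⟩
        r + suc e               ∎))
      where
      open ℕP.≤-Reasoning
      K≤sum : K ℕ.≤ suc e + r
      K≤sum = ℕP.≮⇒≥ large
      r≤wrapped : r ℕ.≤ suc e + r ∸ K
      r≤wrapped = begin
        r                       ≡⟨ ≡-sym eq ⟩
        (suc e + r) % K         ≡⟨ ≡-sym (m≤n⇒[n∸m]%m≡n%m K≤sum) ⟩
        (suc e + r ∸ K) % K     ≤⟨ m%n≤m (suc e + r ∸ K) K ⟩
        suc e + r ∸ K           ∎

  consec⇒succ : ∀ {i j : Fin K} → CycConsec i j → toℕ j ≡ suc (toℕ i) % K
  consec⇒succ {i} {j} (inj₁ j≡1+i) =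
    trans j≡1+i (≡-sym (m<n⇒m%n≡m (subst (ℕ._< K) j≡1+i (FinP.toℕ<n j))))
  consec⇒succ {i} {j} (inj₂ (i≡k , j≡0)) =
    trans j≡0 (≡-sym (trans (cong (λ t → suc t % K) i≡k) (n%n≡0 K)))

  succ⇒consec : ∀ {i j : Fin K} → toℕ j ≡ suc (toℕ i) % K → CycConsec i j
  succ⇒consec {i} {j} eq with suc (toℕ i) ℕP.<? K
  ... | yes inside = inj₁ (trans eq (m<n⇒m%n≡m inside))
  ... | no outside = inj₂ (i≡k , trans eq (trans (cong (λ t → suc t % K) i≡k) (n%n≡0 K)))
    where
    i≡k : toℕ i ≡ k
    i≡k = ℕP.≤-antisym (ℕP.≤-pred (FinP.toℕ<n i)) (ℕP.≤-pred (ℕP.≮⇒≥ outside))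

  position-consec : ∀ x → CycConsec (position x) (position (suc x))
  position-consec x = succ⇒consec (begin
    toℕ (position (suc x))      ≡⟨ toℕ-position (suc x) ⟩
    suc x % K                   ≡⟨ %-absorbʳ 1 x ⟩
    suc (x % K) % K             ≡⟨ cong (λ t → suc t % K) (≡-sym (toℕ-position x)) ⟩
    suc (toℕ (position x)) % K  ∎)
    where open ≡-Reasoning

  consecutive-positions : ∀ x y → CycConsec (position x) (position y) → y % K ≡ suc x % K
  consecutive-positions x y cc = begin
    y % K                       ≡⟨ ≡-sym (toℕ-position y) ⟩
    toℕ (position y)            ≡⟨ consec⇒succ cc ⟩
    suc (toℕ (position x)) % K  ≡⟨ cong (λ t → suc t % K) (toℕ-position x) ⟩
    suc (x % K) % K             ≡⟨ ≡-sym (%-absorbʳ 1 x) ⟩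
    suc x % K                   ∎
    where open ≡-Reasoning

  position-distinct : ∀ e x → suc e ℕ.< K → position x ≢ position (suc e + x)
  position-distinct e x e<K eq = shift-moves e x e<K (begin
    (suc e + x) % K             ≡⟨ ≡-sym (toℕ-position (suc e + x)) ⟩
    toℕ (position (suc e + x))  ≡⟨ cong toℕ (≡-sym eq) ⟩
    toℕ (position x)            ≡⟨ toℕ-position x ⟩
    x % K                       ∎)
    where open ≡-Reasoning

  position-wrap : ∀ i → position (K + toℕ i) ≡ i
  position-wrap i = FinP.toℕ-injective (begin
    toℕ (position (K + toℕ i))  ≡⟨ toℕ-position (K + toℕ i) ⟩
    (K + toℕ i) % K             ≡⟨ cong (_% K) (ℕP.+-comm K (toℕ i)) ⟩
    (toℕ i + K) % K             ≡⟨ [m+n]%n≡m%n (toℕ i) K ⟩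
    toℕ i % K                   ≡⟨ m<n⇒m%n≡m (FinP.toℕ<n i) ⟩
    toℕ i                       ∎)
    where open ≡-Reasoning

  Apart : Fin K → Fin K → Set
  Apart i j = i ≢ j × ¬ CycConsec i j × ¬ CycConsec j i

  Apart-sym : ∀ {i j} → Apart i j → Apart j i
  Apart-sym (i≢j , ¬ij , ¬ji) = ≢-sym i≢j , ¬ji , ¬ij

  position-apart : ∀ e x → 3 + e ℕ.< K → Apart (position x) (position (2 + e + x))
  position-apart e x 3+e<K = distinct , not-forward , not-backward
    where
    distinct : position x ≢ position (2 + e + x)
    distinct = position-distinct (suc e) x (ℕP.m+n≤o⇒n≤o 1 3+e<K)
    not-forward : ¬ CycConsec (position x) (position (2 + e + x))
    not-forward cc = shift-moves e (suc x) (ℕP.m+n≤o⇒n≤o 2 3+e<K)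
      (trans (cong (λ t → suc t % K) (ℕP.+-suc e x)) (consecutive-positions x (2 + e + x) cc))
    not-backward : ¬ CycConsec (position (2 + e + x)) (position x)
    not-backward cc = shift-moves (2 + e) x 3+e<K (≡-sym (consecutive-positions (2 + e + x) x cc))

module LongCycles {n} (G : Graph n) (qpo : IsQPO G) (j : ℕ)
  (f : Fin (5 + j) → Fin n) (cycle : IsCycle G (5 + j) f) where
  open CyclicPositions (4 + j)

  2<K : 2 ℕ.< K
  2<K = s≤s (s≤s (s≤s z≤n))
  3<K : 3 ℕ.< K
  3<K = s≤s (s≤s (s≤s (s≤s z≤n)))
  4<K : 4 ℕ.< K
  4<K = s≤s (s≤s (s≤s (s≤s (s≤s z≤n))))

  edge : ∀ x → E G (f (position x)) (f (position (suc x)))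
  edge x = proj₂ cycle _ _ (position-consec x)

  chord : ∀ {p q} → Apart p q → E G (f p) (f q) → HasChord G K f
  chord {p} {q} (p≢q , ¬pq , ¬qp) e = p , q , p≢q , ¬pq , ¬qp , e

  -- A descent q0 – q1 – q2 – q3 along the cycle from the maximum f q1, with
  -- f q0 < f q2, is a short candidate path; both possible QPO edges are chords.
  chordAtMaximum : ∀ q0 q1 q2 q3 →
    E G (f q0) (f q1) → E G (f q1) (f q2) → E G (f q2) (f q3) →
    f q0 < f q2 → (∀ q → f q ≤ f q1) → Apart q0 q3 → Apart q1 q3 →
    HasChord G K f
  chordAtMaximum q0 q1 q2 q3 e01 e12 e23 f0<f2 top apart03 apart13
    with shortCandidate G qpo f0<f2 f2<f1 f3<f1 f0≢f3 e01 e12 e23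
    where
    f2<f1 : f q2 < f q1
    f2<f1 = FinP.≤∧≢⇒< (top q2) (≢-sym (adjacent⇒distinct G e12))
    f3<f1 : f q3 < f q1
    f3<f1 = FinP.≤∧≢⇒< (top q3) (λ eq → proj₁ apart13 (≡-sym (proj₁ cycle eq)))
    f0≢f3 : f q0 ≢ f q3
    f0≢f3 = λ eq → proj₁ apart03 (proj₁ cycle eq)
  ... | inj₁ e03 = chord apart03 e03
  ... | inj₂ e13 = chord apart13 e13

  -- With the maximum at position 2 + y, descend towards the smaller of its
  -- two cycle neighbours.
  chordNearMaximum : ∀ y → (∀ q → f q ≤ f (position (2 + y))) → HasChord G K f
  chordNearMaximum y top with FinP.<-cmp (f (position (1 + y))) (f (position (3 + y)))
  ... | tri< lt _ _ = chordAtMaximum (position (1 + y)) (position (2 + y))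
          (position (3 + y)) (position (4 + y)) (edge (1 + y)) (edge (2 + y)) (edge (3 + y))
          lt top (position-apart 1 (1 + y) 4<K) (position-apart 0 (2 + y) 3<K)
  ... | tri≈ _ eq _ = ⊥-elim (position-distinct 1 (1 + y) 2<K (proj₁ cycle eq))
  ... | tri> _ _ gt = chordAtMaximum (position (3 + y)) (position (2 + y))
          (position (1 + y)) (position y)
          (sym G (edge (2 + y))) (sym G (edge (1 + y))) (sym G (edge y))
          gt top (Apart-sym (position-apart 1 y 4<K)) (Apart-sym (position-apart 0 y 3<K))

  -- y = 3 + j + toℕ i makes 2 + y = K + toℕ i, which reaches the maximum i.
  longCycleHasChord : HasChord G K f
  longCycleHasChord with maximumAt f
  ... | i , top = chordNearMaximum (3 + j + toℕ i)
          (λ q → subst (λ p → f q ≤ f p) (≡-sym (position-wrap i)) (top q))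

noTriangle : ∀ {n} (G : Graph n) → TriangleFree G →
  ∀ {x y z} → E G x y → E G y z → E G z x → ⊥
noTriangle {n} G triangleFree {x} {y} {z} exy eyz ezx = triangleFree triangle (injective , edges)
  where
  triangle : Fin 3 → Fin n
  triangle 0F = x
  triangle 1F = y
  triangle 2F = z

  injective : ∀ {i j} → triangle i ≡ triangle j → i ≡ j
  injective {0F} {0F} _  = refl
  injective {0F} {1F} eq = ⊥-elim (adjacent⇒distinct G exy eq)
  injective {0F} {2F} eq = ⊥-elim (adjacent⇒distinct G ezx (≡-sym eq))
  injective {1F} {0F} eq = ⊥-elim (adjacent⇒distinct G exy (≡-sym eq))
  injective {1F} {1F} _  = refl
  injective {1F} {2F} eq = ⊥-elim (adjacent⇒distinct G eyz eq)
  injective {2F} {0F} eq = ⊥-elim (adjacent⇒distinct G ezx eq)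
  injective {2F} {1F} eq = ⊥-elim (adjacent⇒distinct G eyz (≡-sym eq))
  injective {2F} {2F} _  = refl

  successor : ∀ i j → toℕ j ≡ suc (toℕ i) % 3 → E G (triangle i) (triangle j)
  successor 0F 1F _ = exy
  successor 1F 2F _ = eyz
  successor 2F 0F _ = ezx
  successor 0F 0F ()
  successor 0F 2F ()
  successor 1F 0F ()
  successor 1F 1F ()
  successor 2F 1F ()
  successor 2F 2F ()

  edges : ∀ i j → CycConsec i j → E G (triangle i) (triangle j)
  edges i j cc = successor i j (CyclicPositions.consec⇒succ 2 cc)

least : ∀ {m} {P : Fin m → Set} → (∀ x → Dec (P x)) →
  (∀ x → ¬ P x) ⊎ Σ (Fin m) λ x → P x × (∀ {y} → P y → x ≤ y)
least {zero} P? = inj₁ (λ ())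
least {suc m} P? with P? fzero
... | yes p0 = inj₂ (fzero , p0 , λ _ → z≤n)
... | no ¬p0 with least (λ x → P? (fsuc x))
...   | inj₁ none = inj₁ λ { fzero → ¬p0 ; (fsuc x) → none x }
...   | inj₂ (x , px , minimal) =
          inj₂ (fsuc x , px , λ { {fzero} p0 → ⊥-elim (¬p0 p0) ; {fsuc y} py → s≤s (minimal py) })

module Bipartition {n} (G : Graph n) (qpo : IsQPO G) (triangleFree : TriangleFree G) where

  Below : ℕ → Fin n → Set
  Below m u = toℕ u ℕ.< m

  ProperBelow : ℕ → (Fin n → Bool) → Set
  ProperBelow m col = ∀ {u v} → Below m u → Below m v → E G u v → col u ≢ col v

  module Extend (m : ℕ) (m<n : m ℕ.< n) (col : Fin n → Bool) (proper : ProperBelow m col) where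

    c : Fin n
    c = fromℕ< m<n

    toℕ-c : toℕ c ≡ m
    toℕ-c = FinP.toℕ-fromℕ< m<n

    below⇒<c : ∀ {u} → Below m u → u < c
    below⇒<c {u} bu = subst (toℕ u ℕ.<_) (≡-sym toℕ-c) bu

    below⇒≢c : ∀ {u} → Below m u → u ≢ c
    below⇒≢c bu = FinP.<⇒≢ (below⇒<c bu)

    below-suc : ∀ {u} → Below (suc m) u → Below m u ⊎ u ≡ c
    below-suc {u} bu with ℕP.m≤n⇒m<n∨m≡n (ℕP.≤-pred bu)
    ... | inj₁ u<m = inj₁ u<m
    ... | inj₂ u≡m = inj₂ (FinP.toℕ-injective (trans u≡m (≡-sym toℕ-c)))

    recolour : Bool → Fin n → Bool
    recolour β x with x FinP.≟ c | E? G x c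
    ... | yes _ | _     = not β
    ... | no _  | yes _ = β
    ... | no _  | no _  = col x

    recolour-c : ∀ β → recolour β c ≡ not β
    recolour-c β with c FinP.≟ c
    ... | yes _ = refl
    ... | no c≢c = ⊥-elim (c≢c refl)

    recolour-neighbour : ∀ β {x} → Below m x → E G x c → recolour β x ≡ β
    recolour-neighbour β {x} bx exc with x FinP.≟ c | E? G x c
    ... | yes x≡c | _        = ⊥-elim (below⇒≢c bx x≡c)
    ... | no _    | yes _    = refl
    ... | no _    | no ¬exc  = ⊥-elim (¬exc exc)

    recolour-other : ∀ β {x} → Below m x → ¬ E G x c → recolour β x ≡ col x
    recolour-other β {x} bx ¬exc with x FinP.≟ c | E? G x c
    ... | yes x≡c | _        = ⊥-elim (below⇒≢c bx x≡c)
    ... | no _    | yes exc  = ⊥-elim (¬exc exc)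
    ... | no _    | no _     = refl

    Safe : Bool → Set
    Safe β = ∀ {u v} → Below m u → Below m v → E G u c → ¬ E G v c → E G u v → col v ≢ β

    -- With a safe β the recolouring is proper on the vertices below m + 1:
    -- c is only adjacent to recoloured neighbours, which are pairwise
    -- non-adjacent because G has no triangles.
    module _ (β : Bool) (safe : Safe β) where

      c-vs-neighbour : ∀ {v} → Below m v → E G v c → recolour β c ≢ recolour β v
      c-vs-neighbour bv evc rewrite recolour-c β | recolour-neighbour β bv evc = ≢-sym (not-¬ refl)

      neighbour-vs-other : ∀ {u v} → Below m u → Below m v → E G u c → ¬ E G v c → E G u v →
        recolour β u ≢ recolour β v
      neighbour-vs-other bu bv euc ¬evc euv
        rewrite recolour-neighbour β bu euc | recolour-other β bv ¬evc = ≢-sym (safe bu bv euc ¬evc euv)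

      earlier-vs-earlier : ∀ {u v} → Below m u → Below m v → E G u v → recolour β u ≢ recolour β v
      earlier-vs-earlier {u} {v} bu bv euv = byAdjacencyToC (E? G u c) (E? G v c)
        where
        byAdjacencyToC : Dec (E G u c) → Dec (E G v c) → recolour β u ≢ recolour β v
        byAdjacencyToC (yes euc) (yes evc) = ⊥-elim (noTriangle G triangleFree euv evc (sym G euc))
        byAdjacencyToC (yes euc) (no ¬evc) = neighbour-vs-other bu bv euc ¬evc euv
        byAdjacencyToC (no ¬euc) (yes evc) = ≢-sym (neighbour-vs-other bv bu evc ¬euc (sym G euv))
        byAdjacencyToC (no ¬euc) (no ¬evc)
          rewrite recolour-other β bu ¬euc | recolour-other β bv ¬evc = proper bu bv euv

      recolour-proper : ProperBelow (suc m) (recolour β)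
      recolour-proper bu bv euv with below-suc bu | below-suc bv
      ... | inj₂ refl | inj₂ refl = ⊥-elim (irrefl G euv)
      ... | inj₂ refl | inj₁ bv′  = c-vs-neighbour bv′ (sym G euv)
      ... | inj₁ bu′  | inj₂ refl = ≢-sym (c-vs-neighbour bu′ euv)
      ... | inj₁ bu′  | inj₁ bv′  = earlier-vs-earlier bu′ bv′ euv

    -- The colour of the least earlier neighbour a of c is safe: for u, v as
    -- in 'Safe' with a ≠ u, the path a c u v is a short candidate path, and
    -- cv is not an edge, so av is one.
    safeColour : Σ Bool Safe
    safeColour with least (λ x → (toℕ x ℕP.<? m) ×-dec E? G x c)
    ... | inj₁ none = true , λ bu _ euc _ _ → ⊥-elim (none _ (bu , euc))
    ... | inj₂ (a , (ba , eac) , minimal) = col a , avoids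
      where
      avoids : Safe (col a)
      avoids {u} {v} bu bv euc ¬evc euv with a FinP.≟ u
      ... | yes refl = ≢-sym (proper bu bv euv)
      ... | no a≢u with shortCandidate G qpo a<u (below⇒<c bu) (below⇒<c bv) a≢v eac (sym G euc) euv
        where
        a<u : a < u
        a<u = FinP.≤∧≢⇒< (minimal (bu , euc)) a≢u
        a≢v : a ≢ v
        a≢v = λ a≡v → ¬evc (subst (λ w → E G w c) a≡v eac)
      ... | inj₁ eav = ≢-sym (proper ba bv eav)
      ... | inj₂ ecv = ⊥-elim (¬evc (sym G ecv))

    extend : Σ (Fin n → Bool) (ProperBelow (suc m))
    extend = recolour (proj₁ safeColour) , recolour-proper (proj₁ safeColour) (proj₂ safeColour)

  properBelow : ∀ m → m ℕ.≤ n → Σ (Fin n → Bool) (ProperBelow m)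
  properBelow zero    _   = (λ _ → true) , λ ()
  properBelow (suc m) m<n = Extend.extend m m<n (proj₁ previous) (proj₂ previous)
    where
    previous : Σ (Fin n → Bool) (ProperBelow m)
    previous = properBelow m (ℕP.<⇒≤ m<n)

  bipartite : Bipartite G
  bipartite with properBelow n ℕP.≤-refl
  ... | col , proper = col , λ u v → proper (FinP.toℕ<n u) (FinP.toℕ<n v)

mainTheorem16 : ∀ {n} (G : Graph n) → IsQPO G →
    (∀ (k : ℕ) (f : Fin k → Fin n) → k ≥ 5 → IsCycle G k f → HasChord G k f)
    × (TriangleFree G → Bipartite G)
mainTheorem16 G qpo = longCycles , Bipartition.bipartite G qpo
  where
  longCycles : ∀ (k : ℕ) (f : Fin k → Fin _) → k ≥ 5 → IsCycle G k f → HasChord G k f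
  longCycles k f (s≤s (s≤s (s≤s (s≤s (s≤s {n = j} _))))) cycle = LongCycles.longCycleHasChord G qpo j f cycle
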